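{- Let $\mathbf{c}=c_0c_1c_2\cdots\in\{0,1\}^{\infty}$ and let $\bar{\mathbf{c}}=(1-c_i)_{i\geq 0}$. Then $H_n(\mathbf{c})+H_n(\bar{\mathbf{c}})\equiv 1\pmod 2$ for all $n\geq 1$ if and only if the sequence $\mathbf{v}=(v_i)_{i\geq0}\in\{0,1\}^{\infty}$ with $v_i\equiv c_i+c_{i+2}\pmod 2$ is apwenian.
   Context: For an integer sequence $\mathbf{a}$, $H_n(\mathbf{a})=\det(a_{i+j})_{0\leq i,j\leq n-1}$ for $n\geq 1$. A sequence in $\{0,1\}^{\infty}$ is apwenian if all its Hankel determinants $H_n$, $n\geq 1$, are odd. -}

module Defs where

open import Data.Nat as ℕ using (ℕ; zero; suc)
open import Data.Nat.DivMod using (_%_)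
open import Data.Integer using (ℤ; +_; _+_; _*_; -_; ∣_∣)
open import Data.Fin using (Fin; zero; suc; toℕ; punchIn)
open import Data.Bool using (Bool; true; false; not; _xor_)
open import Relation.Binary.PropositionalEquality using (_≡_)

Matrix : ℕ → Set
Matrix n = Fin n → Fin n → ℤ

sgn : ℕ → ℤ
sgn zero = + 1
sgn (suc k) = - sgn k

∑ : ∀ {n} → (Fin n → ℤ) → ℤ
∑ {zero} f = + 0
∑ {suc n} f = f zero + ∑ (λ i → f (suc i))

det : ∀ {n} → Matrix n → ℤ
det {zero} A = + 1
det {suc n} A = ∑ (λ j → sgn (toℕ j) * A zero j * det (λ r c → A (suc r) (punchIn j c)))

Seq : Set
Seq = ℕ → Bool

b2z : Bool → ℤ
b2z true = + 1
b2z false = + 0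

H : ℕ → Seq → ℤ
H n a = det {n} (λ i j → b2z (a (toℕ i ℕ.+ toℕ j)))

Odd : ℤ → Set
Odd z = ∣ z ∣ % 2 ≡ 1

Apwenian : Seq → Set
Apwenian a = ∀ n → 1 ℕ.≤ n → Odd (H n a)

complement : Seq → Seq
complement c i = not (c i)

vSeq : Seq → Seq
vSeq c i = c i xor c (i ℕ.+ 2)

module Submission where

-- Everything is reduced modulo 2.  Reduction mod 2 is a ring homomorphism ℤ → 𝔽₂
-- (𝔽₂ = Bool with xor and ∧), so the parity of an integer determinant is the
-- 𝔽₂-determinant of the reduced matrix.  Over 𝔽₂ we show the identity
--
--     det H_{m+1}(c̄) = det H_{m+1}(c) + det H_m(v)        (m ≥ 0)
--
-- as follows.  Replacing every column j ≥ 1 by (column j − column j−1), and then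
-- doing the same for rows, does not change a determinant.  Applied to the Hankel
-- matrix (c_{i+j}) this yields a matrix with corner c_0 whose lower-right m×m block
-- is the Hankel matrix of v, since c_{k+2} − 2c_{k+1} + c_k ≡ v_k.  For c̄ = 1 − c all
-- differences agree with those of c; only the corner becomes 1 − c_0, and flipping a
-- corner entry changes the determinant by the complementary minor, det H_m(v).
-- Hence H_{m+1}(c) + H_{m+1}(c̄) ≡ H_m(v) (mod 2), which gives the equivalence at
-- once (H_1(c) + H_1(c̄) = c_0 + 1 − c_0 = 1 corresponds to H_0(v) = 1).

open import Defs
open import Data.Nat using (_≤_)
open import Data.Integer using (_+_)
open import Function.Bundles using (_⇔_)

open import Function using (_∘′_)
open import Function.Bundles using (mk⇔; Equivalence)
open import Data.Nat as ℕ using (ℕ; zero; suc; s≤s; z≤n)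
import Data.Nat.Properties as ℕP
open import Data.Nat.DivMod using (_%_; [m+n]%n≡m%n)
open import Data.Integer as ℤ using (ℤ; +_; -[1+_]; ∣_∣; _⊖_)
import Data.Integer.Properties as ℤP
open import Data.Fin as Fin using (Fin; zero; suc; toℕ; punchIn; punchOut; inject₁; fromℕ<)
import Data.Fin.Properties as FinP
open import Data.Bool using (Bool; true; false; not; _xor_; _∧_; if_then_else_)
open import Data.Bool.Properties
  using (not-involutive; xor-assoc; xor-comm; xor-identityʳ; xor-same; not-distribˡ-xor;
         xor-annihilates-not; ∧-distribˡ-xor; ∧-distribʳ-xor; ∧-zeroʳ;
         xor-∧-commutativeRing; ∧-commutativeMonoid)
open import Algebra.Bundles using (CommutativeRing; CommutativeMonoid)
open import Algebra.Properties.CommutativeSemigroup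
  (CommutativeRing.+-commutativeSemigroup xor-∧-commutativeRing)
  using () renaming (interchange to xor-interchange)
open import Algebra.Properties.CommutativeSemigroup
  (CommutativeMonoid.commutativeSemigroup ∧-commutativeMonoid)
  using () renaming (x∙yz≈y∙xz to ∧-left-swap)
open import Data.Sum using (_⊎_; inj₁; inj₂)
open import Data.Product using (Σ; _,_; _×_)
open import Relation.Nullary using (yes; no; does; contradiction)
open import Relation.Nullary.Decidable using (dec-true; dec-false)
open import Relation.Binary.PropositionalEquality
open ≡-Reasoning

Σ₂ : ∀ {n} → (Fin n → Bool) → Bool
Σ₂ {zero} f = false
Σ₂ {suc n} f = f zero xor Σ₂ (λ i → f (suc i))

Σ₂-cong : ∀ {n} {f g : Fin n → Bool} → (∀ i → f i ≡ g i) → Σ₂ f ≡ Σ₂ g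
Σ₂-cong {zero} e = refl
Σ₂-cong {suc n} e = cong₂ _xor_ (e zero) (Σ₂-cong (λ i → e (suc i)))

Σ₂-xor : ∀ {n} (f g : Fin n → Bool) → Σ₂ (λ i → f i xor g i) ≡ Σ₂ f xor Σ₂ g
Σ₂-xor {zero} f g = refl
Σ₂-xor {suc n} f g =
  trans (cong ((f zero xor g zero) xor_) (Σ₂-xor (λ i → f (suc i)) (λ i → g (suc i))))
        (xor-interchange (f zero) (g zero) _ _)

∧-Σ₂ : ∀ {n} a (f : Fin n → Bool) → a ∧ Σ₂ f ≡ Σ₂ (λ i → a ∧ f i)
∧-Σ₂ {zero} a f = ∧-zeroʳ a
∧-Σ₂ {suc n} a f =
  trans (∧-distribˡ-xor a (f zero) _) (cong ((a ∧ f zero) xor_) (∧-Σ₂ a (λ i → f (suc i))))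

Σ₂-zero : ∀ {n} (f : Fin n → Bool) → (∀ i → f i ≡ false) → Σ₂ f ≡ false
Σ₂-zero {zero} f e = refl
Σ₂-zero {suc n} f e = cong₂ _xor_ (e zero) (Σ₂-zero (λ i → f (suc i)) (λ i → e (suc i)))

Σ₂-swap : ∀ {m n} (f : Fin m → Fin n → Bool) →
  Σ₂ (λ i → Σ₂ (λ j → f i j)) ≡ Σ₂ (λ j → Σ₂ (λ i → f i j))
Σ₂-swap {zero} {n} f = sym (Σ₂-zero {n} _ (λ j → refl))
Σ₂-swap {suc m} f =
  trans (cong (Σ₂ (f zero) xor_) (Σ₂-swap (λ i j → f (suc i) j)))
        (sym (Σ₂-xor (f zero) (λ j → Σ₂ (λ i → f (suc i) j))))

Σ₂-adjacent-pair : ∀ {n} (f : Fin (suc n) → Bool) (x : Fin n) →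
  (∀ j → j ≢ inject₁ x → j ≢ suc x → f j ≡ false) → f (inject₁ x) ≡ f (suc x) → Σ₂ f ≡ false
Σ₂-adjacent-pair {suc n} f zero others equal = begin
    f zero xor (f (suc zero) xor Σ₂ (λ k → f (suc (suc k))))
  ≡⟨ cong₂ _xor_ equal (cong (f (suc zero) xor_) rest) ⟩
    f (suc zero) xor (f (suc zero) xor false)
  ≡⟨ cong (f (suc zero) xor_) (xor-identityʳ _) ⟩
    f (suc zero) xor f (suc zero)
  ≡⟨ xor-same (f (suc zero)) ⟩
    false
  ∎
  where
  rest : Σ₂ (λ k → f (suc (suc k))) ≡ false
  rest = Σ₂-zero _ (λ k → others (suc (suc k)) (λ ()) (λ ()))
Σ₂-adjacent-pair {suc n} f (suc x) others equal =
  trans (cong (_xor Σ₂ (λ i → f (suc i))) (others zero (λ ()) (λ ())))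
        (Σ₂-adjacent-pair (λ i → f (suc i)) x
          (λ j p q → others (suc j) (p ∘′ FinP.suc-injective) (q ∘′ FinP.suc-injective)) equal)

-- The determinant over 𝔽₂, by Laplace expansion along the first row (signs vanish).

Mat₂ : ℕ → Set
Mat₂ n = Fin n → Fin n → Bool

minor : ∀ {n} → Mat₂ (suc n) → Fin (suc n) → Mat₂ n
minor A j r c = A (suc r) (punchIn j c)

det₂ : ∀ {n} → Mat₂ n → Bool
det₂ {zero} A = true
det₂ {suc n} A = Σ₂ (λ j → A zero j ∧ det₂ (minor A j))

det₂-cong : ∀ {n} {A B : Mat₂ n} → (∀ i j → A i j ≡ B i j) → det₂ A ≡ det₂ B
det₂-cong {zero} e = refl
det₂-cong {suc n} e =
  Σ₂-cong (λ j → cong₂ _∧_ (e zero j) (det₂-cong (λ r c → e (suc r) (punchIn j c))))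

-- Laplace expansion along the first column, by induction: expand both sides once
-- more and exchange the two resulting double sums.
det₂-expand-column : ∀ {n} (A : Mat₂ (suc n)) →
  det₂ A ≡ Σ₂ (λ i → A i zero ∧ det₂ (λ r c → A (punchIn i r) (suc c)))
det₂-expand-column {zero} A = refl
det₂-expand-column {suc n} A = cong (A zero zero ∧ det₂ (λ r c → A (suc r) (suc c)) xor_) offCorner
  where
  K : Fin (suc n) → Fin (suc n) → Bool
  K i c = det₂ (λ r x → A (suc (punchIn i r)) (suc (punchIn c x)))
  offCorner : Σ₂ (λ c → A zero (suc c) ∧ det₂ (minor A (suc c)))
            ≡ Σ₂ (λ i → A (suc i) zero ∧ det₂ (λ r c → A (punchIn (suc i) r) (suc c)))
  offCorner = begin
      Σ₂ (λ c → A zero (suc c) ∧ det₂ (minor A (suc c)))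
    ≡⟨ Σ₂-cong (λ c → cong (A zero (suc c) ∧_) (det₂-expand-column (minor A (suc c)))) ⟩
      Σ₂ (λ c → A zero (suc c) ∧ Σ₂ (λ i → A (suc i) zero ∧ K i c))
    ≡⟨ Σ₂-cong (λ c → ∧-Σ₂ (A zero (suc c)) (λ i → A (suc i) zero ∧ K i c)) ⟩
      Σ₂ (λ c → Σ₂ (λ i → A zero (suc c) ∧ (A (suc i) zero ∧ K i c)))
    ≡⟨ Σ₂-swap (λ c i → A zero (suc c) ∧ (A (suc i) zero ∧ K i c)) ⟩
      Σ₂ (λ i → Σ₂ (λ c → A zero (suc c) ∧ (A (suc i) zero ∧ K i c)))
    ≡⟨ Σ₂-cong (λ i → Σ₂-cong (λ c → ∧-left-swap (A zero (suc c)) (A (suc i) zero) (K i c))) ⟩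
      Σ₂ (λ i → Σ₂ (λ c → A (suc i) zero ∧ (A zero (suc c) ∧ K i c)))
    ≡⟨ Σ₂-cong (λ i → ∧-Σ₂ (A (suc i) zero) (λ c → A zero (suc c) ∧ K i c)) ⟨
      Σ₂ (λ i → A (suc i) zero ∧ Σ₂ (λ c → A zero (suc c) ∧ K i c))
    ∎

-- Row expansion of the transpose is column expansion of the original.
det₂-transpose : ∀ {n} (A : Mat₂ n) → det₂ (λ i j → A j i) ≡ det₂ A
det₂-transpose {zero} A = refl
det₂-transpose {suc n} A = trans
  (Σ₂-cong (λ j → cong (A j zero ∧_) (det₂-transpose (λ r c → A (punchIn j r) (suc c)))))
  (sym (det₂-expand-column A))

det₂-additive-column : ∀ {n} (A B C : Mat₂ n) (l : Fin n) →
  (∀ i j → j ≢ l → A i j ≡ C i j) → (∀ i j → j ≢ l → B i j ≡ C i j) →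
  (∀ i → C i l ≡ A i l xor B i l) → det₂ C ≡ det₂ A xor det₂ B
det₂-additive-column {suc n} A B C l offA offB onl =
  trans (Σ₂-cong term) (Σ₂-xor (λ j → A zero j ∧ det₂ (minor A j)) (λ j → B zero j ∧ det₂ (minor B j)))
  where
  term : ∀ j → C zero j ∧ det₂ (minor C j)
             ≡ (A zero j ∧ det₂ (minor A j)) xor (B zero j ∧ det₂ (minor B j))
  -- deleting column l itself: all three minors coincide
  term j with j Fin.≟ l
  ... | yes refl =
    trans (cong₂ _∧_ (onl zero) (det₂-cong (λ r c → sym (offA (suc r) (punchIn j c) (FinP.punchInᵢ≢i j c)))))
      (trans (∧-distribʳ-xor _ (A zero j) (B zero j))
        (cong ((A zero j ∧ det₂ (minor A j)) xor_)
          (cong (B zero j ∧_) (det₂-cong (λ r c → trans (offA (suc r) (punchIn j c) (FinP.punchInᵢ≢i j c))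
                                                        (sym (offB (suc r) (punchIn j c) (FinP.punchInᵢ≢i j c))))))))
  -- deleting another column: induction, column l becomes column punchOut l
  ... | no j≢l =
    trans (cong (C zero j ∧_) minorsAdd)
      (trans (∧-distribˡ-xor (C zero j) _ _)
        (cong₂ _xor_ (cong (_∧ det₂ (minor A j)) (sym (offA zero j j≢l)))
                     (cong (_∧ det₂ (minor B j)) (sym (offB zero j j≢l)))))
    where
    l′ = punchOut j≢l
    l≡ = FinP.punchIn-punchOut j≢l
    off : ∀ c → c ≢ l′ → punchIn j c ≢ l
    off c c≢l′ e = c≢l′ (FinP.punchIn-injective j c l′ (trans e (sym l≡)))
    minorsAdd : det₂ (minor C j) ≡ det₂ (minor A j) xor det₂ (minor B j)
    minorsAdd = det₂-additive-column (minor A j) (minor B j) (minor C j) l′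
      (λ r c c≢ → offA (suc r) (punchIn j c) (off c c≢))
      (λ r c c≢ → offB (suc r) (punchIn j c) (off c c≢))
      (λ r → trans (cong (C (suc r)) l≡)
               (trans (onl (suc r)) (sym (cong₂ _xor_ (cong (A (suc r)) l≡) (cong (B (suc r)) l≡)))))

punchIn-keeps-adjacent : ∀ {n} (j : Fin (suc (suc n))) (x : Fin (suc n)) →
  j ≢ inject₁ x → j ≢ suc x →
  Σ (Fin n) λ x′ → punchIn j (inject₁ x′) ≡ inject₁ x × punchIn j (suc x′) ≡ suc x
punchIn-keeps-adjacent zero zero p q = contradiction refl p
punchIn-keeps-adjacent zero (suc x) p q = x , refl , refl
punchIn-keeps-adjacent {zero} (suc zero) zero p q = contradiction refl q
punchIn-keeps-adjacent {suc n} (suc zero) zero p q = contradiction refl q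
punchIn-keeps-adjacent {suc n} (suc (suc j)) zero p q = zero , refl , refl
punchIn-keeps-adjacent {suc n} (suc j) (suc x) p q
  with punchIn-keeps-adjacent j x (p ∘′ cong suc) (q ∘′ cong suc)
... | x′ , e₁ , e₂ = suc x′ , cong suc e₁ , cong suc e₂

punchIn-adjacent : ∀ {n} (x c : Fin n) →
  punchIn (inject₁ x) c ≡ punchIn (suc x) c ⊎
  (punchIn (inject₁ x) c ≡ suc x × punchIn (suc x) c ≡ inject₁ x)
punchIn-adjacent zero zero = inj₂ (refl , refl)
punchIn-adjacent zero (suc c) = inj₁ refl
punchIn-adjacent (suc x) zero = inj₁ refl
punchIn-adjacent (suc x) (suc c) with punchIn-adjacent x c
... | inj₁ e = inj₁ (cong suc e)
... | inj₂ (e₁ , e₂) = inj₂ (cong suc e₁ , cong suc e₂)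

-- A matrix with two equal adjacent columns has determinant 0: in the first-row
-- expansion the minors avoiding the pair vanish by induction, and the two terms
-- for the pair are equal and cancel.
det₂-adjacent-equal-columns : ∀ {n} (A : Mat₂ (suc n)) (x : Fin n) →
  (∀ i → A i (inject₁ x) ≡ A i (suc x)) → det₂ A ≡ false
det₂-adjacent-equal-columns {suc n} A x same =
  Σ₂-adjacent-pair (λ j → A zero j ∧ det₂ (minor A j)) x outside pair
  where
  outside : ∀ j → j ≢ inject₁ x → j ≢ suc x → A zero j ∧ det₂ (minor A j) ≡ false
  outside j p q with punchIn-keeps-adjacent j x p q
  ... | x′ , e₁ , e₂ = trans (cong (A zero j ∧_) (det₂-adjacent-equal-columns (minor A j) x′
           (λ r → trans (cong (A (suc r)) e₁) (trans (same (suc r)) (sym (cong (A (suc r)) e₂))))))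
           (∧-zeroʳ _)
  sameMinor : ∀ r c → A (suc r) (punchIn (inject₁ x) c) ≡ A (suc r) (punchIn (suc x) c)
  sameMinor r c with punchIn-adjacent x c
  ... | inj₁ e = cong (A (suc r)) e
  ... | inj₂ (e₁ , e₂) =
    trans (cong (A (suc r)) e₁) (trans (sym (same (suc r))) (sym (cong (A (suc r)) e₂)))
  pair : A zero (inject₁ x) ∧ det₂ (minor A (inject₁ x)) ≡ A zero (suc x) ∧ det₂ (minor A (suc x))
  pair = cong₂ _∧_ (same zero) (det₂-cong sameMinor)

det₂-add-adjacent-column : ∀ {n} (A C : Mat₂ (suc n)) (x : Fin n) →
  (∀ i j → j ≢ suc x → C i j ≡ A i j) →
  (∀ i → C i (suc x) ≡ A i (suc x) xor A i (inject₁ x)) → det₂ C ≡ det₂ A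
det₂-add-adjacent-column A C x off on = begin
    det₂ C
  ≡⟨ det₂-additive-column A B C (suc x) (λ i j ne → sym (off i j ne)) offB onB ⟩
    det₂ A xor det₂ B
  ≡⟨ cong (det₂ A xor_) (det₂-adjacent-equal-columns B x equalB) ⟩
    det₂ A xor false
  ≡⟨ xor-identityʳ _ ⟩
    det₂ A
  ∎
  where
  B : Mat₂ _
  B i j = if does (j Fin.≟ suc x) then A i (inject₁ x) else A i j
  B-at : ∀ i → B i (suc x) ≡ A i (inject₁ x)
  B-at i rewrite dec-true (suc x Fin.≟ suc x) refl = refl
  B-off : ∀ i j → j ≢ suc x → B i j ≡ A i j
  B-off i j ne rewrite dec-false (j Fin.≟ suc x) ne = refl
  inject₁≢suc : inject₁ x ≢ suc x
  inject₁≢suc e = ℕP.1+n≢n (sym (trans (sym (FinP.toℕ-inject₁ x)) (cong toℕ e)))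
  offB : ∀ i j → j ≢ suc x → B i j ≡ C i j
  offB i j ne = trans (B-off i j ne) (sym (off i j ne))
  onB : ∀ i → C i (suc x) ≡ A i (suc x) xor B i (suc x)
  onB i = trans (on i) (cong (A i (suc x) xor_) (sym (B-at i)))
  equalB : ∀ i → B i (inject₁ x) ≡ B i (suc x)
  equalB i = trans (B-off i (inject₁ x) inject₁≢suc) (sym (B-at i))

det₂-flip-corner : ∀ {n} (A B : Mat₂ (suc n)) → B zero zero ≡ not (A zero zero) →
  (∀ j → B zero (suc j) ≡ A zero (suc j)) → (∀ i j → B (suc i) j ≡ A (suc i) j) →
  det₂ B ≡ det₂ A xor det₂ (minor A zero)
det₂-flip-corner A B corner row rest = begin
    B zero zero ∧ det₂ (minor B zero) xor Σ₂ (λ j → B zero (suc j) ∧ det₂ (minor B (suc j)))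
  ≡⟨ cong₂ _xor_ (cong₂ _∧_ corner D-eq)
       (Σ₂-cong (λ j → cong₂ _∧_ (row j) (det₂-cong (λ r c → rest r (punchIn (suc j) c))))) ⟩
    not (A zero zero) ∧ D xor S
  ≡⟨ flip (A zero zero) D S ⟩
    (A zero zero ∧ D xor S) xor D
  ∎
  where
  D = det₂ (minor A zero)
  S = Σ₂ (λ j → A zero (suc j) ∧ det₂ (minor A (suc j)))
  D-eq : det₂ (minor B zero) ≡ D
  D-eq = det₂-cong (λ r c → rest r (suc c))
  flip : ∀ a d s → not a ∧ d xor s ≡ (a ∧ d xor s) xor d
  flip true true true = refl
  flip true true false = refl
  flip true false s = sym (xor-identityʳ s)
  flip false true true = refl
  flip false true false = refl
  flip false false s = sym (xor-identityʳ s)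

-- Differencing of ℕ-indexed arrays.  An array is an infinite matrix; `block n g`
-- is its upper-left n×n part.

Array : Set
Array = ℕ → ℕ → Bool

block : (n : ℕ) → Array → Mat₂ n
block n g i j = g (toℕ i) (toℕ j)

transposeA : Array → Array
transposeA g i j = g j i

addColumn : ℕ → Array → Array
addColumn l g i j = if does (j ℕ.≟ suc l) then g i j xor g i l else g i j

addColumn-at : ∀ l g i → addColumn l g i (suc l) ≡ g i (suc l) xor g i l
addColumn-at l g i rewrite dec-true (suc l ℕ.≟ suc l) refl = refl

addColumn-off : ∀ l g i j → j ≢ suc l → addColumn l g i j ≡ g i j
addColumn-off l g i j ne rewrite dec-false (j ℕ.≟ suc l) ne = refl

det₂-addColumn : ∀ n l g → l ℕ.< n →
  det₂ (block (suc n) (addColumn l g)) ≡ det₂ (block (suc n) g)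
det₂-addColumn n l g l<n = det₂-add-adjacent-column (block (suc n) g) (block (suc n) (addColumn l g)) x off on
  where
  x = fromℕ< l<n
  x≡l : toℕ x ≡ l
  x≡l = FinP.toℕ-fromℕ< l<n
  off : ∀ i j → j ≢ suc x → addColumn l g (toℕ i) (toℕ j) ≡ g (toℕ i) (toℕ j)
  off i j ne = addColumn-off l g (toℕ i) (toℕ j)
    (λ e → ne (FinP.toℕ-injective (trans e (cong suc (sym x≡l)))))
  on : ∀ i → addColumn l g (toℕ i) (suc (toℕ x)) ≡ g (toℕ i) (suc (toℕ x)) xor g (toℕ i) (toℕ (inject₁ x))
  on i rewrite FinP.toℕ-inject₁ x | x≡l = addColumn-at l g (toℕ i)

diffColumns : Array → Array
diffColumns g i zero = g i zero
diffColumns g i (suc j) = g i (suc j) xor g i j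

diffRows : Array → Array
diffRows g = transposeA (diffColumns (transposeA g))

-- Add column l to column l+1 successively for l = k−1, …, 1, 0.  Working from the
-- right, each column is modified while its left neighbour is still original, so
-- the first k+1 columns end up differenced and the others are untouched.
addColumns : ℕ → Array → Array
addColumns zero g = g
addColumns (suc k) g = addColumns k (addColumn k g)

det₂-addColumns : ∀ n k g → k ℕ.≤ n →
  det₂ (block (suc n) (addColumns k g)) ≡ det₂ (block (suc n) g)
det₂-addColumns n zero g _ = refl
det₂-addColumns n (suc k) g k<n =
  trans (det₂-addColumns n k (addColumn k g) (ℕP.<⇒≤ k<n)) (det₂-addColumn n k g k<n)

addColumns-above : ∀ k g i j → k ℕ.< j → addColumns k g i j ≡ g i j
addColumns-above zero g i j _ = refl
addColumns-above (suc k) g i j k<j =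
  trans (addColumns-above k (addColumn k g) i j (ℕP.<⇒≤ k<j))
        (addColumn-off k g i j (λ e → ℕP.<⇒≢ k<j (sym e)))

addColumns-upTo : ∀ k g i j → j ℕ.≤ k → addColumns k g i j ≡ diffColumns g i j
addColumns-upTo zero g i zero _ = refl
addColumns-upTo (suc k) g i j j≤1+k with j ℕ.≟ suc k
... | yes refl = trans (addColumns-above k (addColumn k g) i (suc k) ℕP.≤-refl) (addColumn-at k g i)
... | no j≢1+k = trans (addColumns-upTo k (addColumn k g) i j j≤k) (unchanged j j≤k)
  where
  j≤k : j ℕ.≤ k
  j≤k = ℕP.≤-pred (ℕP.≤∧≢⇒< j≤1+k j≢1+k)
  -- column k+1 is not involved in differencing columns 0, …, k
  unchanged : ∀ j → j ℕ.≤ k → diffColumns (addColumn k g) i j ≡ diffColumns g i j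
  unchanged zero _ = addColumn-off k g i zero (λ ())
  unchanged (suc j) 1+j≤k = cong₂ _xor_
    (addColumn-off k g i (suc j) (λ e → ℕP.<-irrefl e (s≤s 1+j≤k)))
    (addColumn-off k g i j (λ e → ℕP.<-irrefl e (ℕP.≤-trans 1+j≤k (ℕP.n≤1+n k))))

det₂-diffColumns : ∀ n g → det₂ (block (suc n) (diffColumns g)) ≡ det₂ (block (suc n) g)
det₂-diffColumns n g =
  trans (det₂-cong (λ i j → sym (addColumns-upTo n g (toℕ i) (toℕ j) (ℕP.≤-pred (FinP.toℕ<n j)))))
        (det₂-addColumns n n g ℕP.≤-refl)

det₂-diffRows : ∀ n g → det₂ (block (suc n) (diffRows g)) ≡ det₂ (block (suc n) g)
det₂-diffRows n g =
  trans (det₂-transpose (block (suc n) (diffColumns (transposeA g))))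
        (trans (det₂-diffColumns n (transposeA g)) (det₂-transpose (block (suc n) g)))

-- Reduction modulo 2, ℤ → 𝔽₂, and its compatibility with the determinant.

parityℕ : ℕ → Bool
parityℕ zero = false
parityℕ (suc n) = not (parityℕ n)

parityℤ : ℤ → Bool
parityℤ z = parityℕ ∣ z ∣

parityℕ-+ : ∀ m n → parityℕ (m ℕ.+ n) ≡ parityℕ m xor parityℕ n
parityℕ-+ zero n = refl
parityℕ-+ (suc m) n = trans (cong not (parityℕ-+ m n)) (not-distribˡ-xor (parityℕ m) (parityℕ n))

parityℕ-* : ∀ m n → parityℕ (m ℕ.* n) ≡ parityℕ m ∧ parityℕ n
parityℕ-* zero n = refl
parityℕ-* (suc m) n = begin
    parityℕ (n ℕ.+ m ℕ.* n)
  ≡⟨ parityℕ-+ n (m ℕ.* n) ⟩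
    parityℕ n xor parityℕ (m ℕ.* n)
  ≡⟨ cong (parityℕ n xor_) (parityℕ-* m n) ⟩
    parityℕ n xor (parityℕ m ∧ parityℕ n)
  ≡⟨ absorb (parityℕ m) (parityℕ n) ⟩
    not (parityℕ m) ∧ parityℕ n
  ∎
  where
  absorb : ∀ a b → b xor (a ∧ b) ≡ not a ∧ b
  absorb true b = xor-same b
  absorb false b = xor-identityʳ b

parityℕ-⊖ : ∀ m n → parityℕ ∣ m ⊖ n ∣ ≡ parityℕ m xor parityℕ n
parityℕ-⊖ zero zero = refl
parityℕ-⊖ zero (suc n) = refl
parityℕ-⊖ (suc m) zero = sym (xor-identityʳ _)
parityℕ-⊖ (suc m) (suc n) =
  trans (cong (λ z → parityℕ ∣ z ∣) (ℤP.[1+m]⊖[1+n]≡m⊖n m n))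
        (trans (parityℕ-⊖ m n) (sym (xor-annihilates-not (parityℕ m) (parityℕ n))))

parityℤ-+ : ∀ x y → parityℤ (x ℤ.+ y) ≡ parityℤ x xor parityℤ y
parityℤ-+ (+ m) (+ n) = parityℕ-+ m n
parityℤ-+ (+ m) -[1+ n ] = parityℕ-⊖ m (suc n)
parityℤ-+ -[1+ m ] (+ n) = trans (parityℕ-⊖ n (suc m)) (xor-comm (parityℕ n) _)
parityℤ-+ -[1+ m ] -[1+ n ] =
  trans (not-involutive _) (trans (parityℕ-+ m n) (sym (xor-annihilates-not (parityℕ m) (parityℕ n))))

parityℤ-* : ∀ x y → parityℤ (x ℤ.* y) ≡ parityℤ x ∧ parityℤ y
parityℤ-* x y = trans (cong parityℕ (ℤP.abs-* x y)) (parityℕ-* ∣ x ∣ ∣ y ∣)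

parityℤ-sgn : ∀ k → parityℤ (sgn k) ≡ true
parityℤ-sgn zero = refl
parityℤ-sgn (suc k) = trans (cong parityℕ (ℤP.∣-i∣≡∣i∣ (sgn k))) (parityℤ-sgn k)

parityℤ-∑ : ∀ {n} (f : Fin n → ℤ) → parityℤ (∑ f) ≡ Σ₂ (λ i → parityℤ (f i))
parityℤ-∑ {zero} f = refl
parityℤ-∑ {suc n} f =
  trans (parityℤ-+ (f zero) _) (cong (parityℤ (f zero) xor_) (parityℤ-∑ (λ i → f (suc i))))

parityℤ-det : ∀ {n} (A : Matrix n) → parityℤ (det A) ≡ det₂ (λ i j → parityℤ (A i j))
parityℤ-det {zero} A = refl
parityℤ-det {suc n} A =
  trans (parityℤ-∑ (λ j → sgn (toℕ j) ℤ.* A zero j ℤ.* det (λ r c → A (suc r) (punchIn j c))))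
        (Σ₂-cong term)
  where
  term : ∀ j → parityℤ (sgn (toℕ j) ℤ.* A zero j ℤ.* det (λ r c → A (suc r) (punchIn j c)))
             ≡ parityℤ (A zero j) ∧ det₂ (minor (λ i j → parityℤ (A i j)) j)
  term j = trans (parityℤ-* (sgn (toℕ j) ℤ.* A zero j) _)
    (cong₂ _∧_ (trans (parityℤ-* (sgn (toℕ j)) (A zero j)) (cong (_∧ parityℤ (A zero j)) (parityℤ-sgn (toℕ j))))
               (parityℤ-det (λ r c → A (suc r) (punchIn j c))))

%2-parity : ∀ n → n % 2 ≡ (if parityℕ n then 1 else 0)
%2-parity zero = refl
%2-parity (suc zero) = refl
%2-parity (suc (suc n)) =
  trans (cong (_% 2) (ℕP.+-comm 2 n))
    (trans ([m+n]%n≡m%n n 2)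
      (trans (%2-parity n) (cong (λ b → if b then 1 else 0) (sym (not-involutive (parityℕ n))))))

Odd-resp-parity : ∀ x y → parityℤ x ≡ parityℤ y → Odd x → Odd y
Odd-resp-parity x y same oddX =
  trans (%2-parity ∣ y ∣) (cong (λ b → if b then 1 else 0) (trans (sym same) (oddParity x oddX)))
  where
  oddParity : ∀ z → Odd z → parityℤ z ≡ true
  oddParity z o with parityℕ ∣ z ∣ | %2-parity ∣ z ∣
  ... | true | _ = refl
  ... | false | e with () ← trans (sym o) e

hankel : Seq → Array
hankel a i j = a (i ℕ.+ j)

parityℤ-H : ∀ n a → parityℤ (H n a) ≡ det₂ (block n (hankel a))
parityℤ-H n a = trans (parityℤ-det {n} (λ i j → b2z (a (toℕ i ℕ.+ toℕ j))))
                      (det₂-cong {n} (λ i j → b2z-parity (a (toℕ i ℕ.+ toℕ j))))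
  where
  b2z-parity : ∀ b → parityℤ (b2z b) ≡ b
  b2z-parity true = refl
  b2z-parity false = refl

diff² : Array → Array
diff² g = diffColumns (diffRows g)

det₂-diff² : ∀ n g → det₂ (block (suc n) (diff² g)) ≡ det₂ (block (suc n) g)
det₂-diff² n g = trans (det₂-diffColumns n (diffRows g)) (det₂-diffRows n g)

-- Away from the first row and column, the second differences of the Hankel array
-- of c form the Hankel array of v: c_{k+2} − 2c_{k+1} + c_k ≡ c_k + c_{k+2}.
diff²-hankel-interior : ∀ c i j → diff² (hankel c) (suc i) (suc j) ≡ vSeq c (i ℕ.+ j)
diff²-hankel-interior c i j = begin
    (c (suc (i ℕ.+ suc j)) xor c (i ℕ.+ suc j)) xor (c (suc (i ℕ.+ j)) xor c (i ℕ.+ j))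
  ≡⟨ cong (λ t → (c (suc t) xor c t) xor (c (suc (i ℕ.+ j)) xor c (i ℕ.+ j))) (ℕP.+-suc i j) ⟩
    (c (2 ℕ.+ (i ℕ.+ j)) xor c (suc (i ℕ.+ j))) xor (c (suc (i ℕ.+ j)) xor c (i ℕ.+ j))
  ≡⟨ telescope (c (2 ℕ.+ (i ℕ.+ j))) (c (suc (i ℕ.+ j))) (c (i ℕ.+ j)) ⟩
    c (i ℕ.+ j) xor c (2 ℕ.+ (i ℕ.+ j))
  ≡⟨ cong (λ t → c (i ℕ.+ j) xor c t) (ℕP.+-comm 2 (i ℕ.+ j)) ⟩
    vSeq c (i ℕ.+ j)
  ∎
  where
  telescope : ∀ a b d → (a xor b) xor (b xor d) ≡ d xor a
  telescope true true true = refl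
  telescope true true false = refl
  telescope true false true = refl
  telescope true false false = refl
  telescope false true true = refl
  telescope false true false = refl
  telescope false false true = refl
  telescope false false false = refl

-- Complementing c leaves all first differences c_{k+1} − c_k unchanged, so the
-- second-difference arrays of c and c̄ agree except at the corner.
diff²-hankel-complement-row : ∀ c i j →
  diff² (hankel (complement c)) (suc i) j ≡ diff² (hankel c) (suc i) j
diff²-hankel-complement-row c i zero = xor-annihilates-not (c (suc i ℕ.+ 0)) (c (i ℕ.+ 0))
diff²-hankel-complement-row c i (suc j) =
  cong₂ _xor_ (xor-annihilates-not (c (suc i ℕ.+ suc j)) (c (i ℕ.+ suc j)))
              (xor-annihilates-not (c (suc i ℕ.+ j)) (c (i ℕ.+ j)))

diff²-hankel-complement-top : ∀ c j →
  diff² (hankel (complement c)) zero (suc j) ≡ diff² (hankel c) zero (suc j)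
diff²-hankel-complement-top c j = xor-annihilates-not (c (suc j)) (c j)

det₂-hankel-complement : ∀ c m →
  det₂ (block (suc m) (hankel (complement c)))
    ≡ det₂ (block (suc m) (hankel c)) xor det₂ (block m (hankel (vSeq c)))
det₂-hankel-complement c m = begin
    det₂ (block (suc m) (hankel (complement c)))
  ≡⟨ det₂-diff² m (hankel (complement c)) ⟨
    det₂ (block (suc m) (diff² (hankel (complement c))))
  ≡⟨ det₂-flip-corner D (block (suc m) (diff² (hankel (complement c)))) refl
       (λ j → diff²-hankel-complement-top c (toℕ j))
       (λ i j → diff²-hankel-complement-row c (toℕ i) (toℕ j)) ⟩
    det₂ D xor det₂ (minor D zero)
  ≡⟨ cong₂ _xor_ (det₂-diff² m (hankel c))
                 (det₂-cong {m} (λ i j → diff²-hankel-interior c (toℕ i) (toℕ j))) ⟩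
    det₂ (block (suc m) (hankel c)) xor det₂ (block m (hankel (vSeq c)))
  ∎
  where
  D = block (suc m) (diff² (hankel c))

parity-hankel-sum : ∀ c m →
  parityℤ (H (suc m) c + H (suc m) (complement c)) ≡ parityℤ (H m (vSeq c))
parity-hankel-sum c m = begin
    parityℤ (H (suc m) c + H (suc m) (complement c))
  ≡⟨ parityℤ-+ (H (suc m) c) (H (suc m) (complement c)) ⟩
    parityℤ (H (suc m) c) xor parityℤ (H (suc m) (complement c))
  ≡⟨ cong₂ _xor_ (parityℤ-H (suc m) c)
                 (trans (parityℤ-H (suc m) (complement c)) (det₂-hankel-complement c m)) ⟩
    d xor (d xor dᵥ)
  ≡⟨ xor-assoc d d dᵥ ⟨
    (d xor d) xor dᵥ
  ≡⟨ cong (_xor dᵥ) (xor-same d) ⟩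
    dᵥ
  ≡⟨ parityℤ-H m (vSeq c) ⟨
    parityℤ (H m (vSeq c))
  ∎
  where
  d = det₂ (block (suc m) (hankel c))
  dᵥ = det₂ (block m (hankel (vSeq c)))

odd-shift : ∀ c m → Odd (H (suc m) c + H (suc m) (complement c)) ⇔ Odd (H m (vSeq c))
odd-shift c m = mk⇔ (Odd-resp-parity sum hᵥ same) (Odd-resp-parity hᵥ sum (sym same))
  where
  sum = H (suc m) c + H (suc m) (complement c)
  hᵥ = H m (vSeq c)
  same = parity-hankel-sum c m

proposition7p3 : (c : Seq) → (∀ n → 1 ≤ n → Odd (H n c + H n (complement c))) ⇔ Apwenian (vSeq c)
proposition7p3 c = mk⇔ to from
  where
  to : (∀ n → 1 ≤ n → Odd (H n c + H n (complement c))) → Apwenian (vSeq c)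
  to odd (suc m) _ = Equivalence.to (odd-shift c (suc m)) (odd (suc (suc m)) (s≤s z≤n))
  from : Apwenian (vSeq c) → ∀ n → 1 ≤ n → Odd (H n c + H n (complement c))
  -- n = 1 corresponds to the empty determinant H_0(v) = 1
  from apw (suc zero) _ = Equivalence.from (odd-shift c zero) refl
  from apw (suc (suc m)) _ = Equivalence.from (odd-shift c (suc m)) (apw (suc m) (s≤s z≤n))
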